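{- \begin{enumerate} \item[(i)] $\mathsf I(=) \nvdash \forall x \exists y (y^r \leqslant x \wedge \neg (Sy)^r \leqslant x)$ for all $r \geqslant 2$ (i.e. the existence of the integer part of $r$-th roots is unprovable); \item[(ii)] $\mathsf I(=) \nvdash \mathsf I(\leqslant)$ and $\mathsf I(=) \nvdash \mathsf I(\not\leqslant)$. \end{enumerate}
   Context: $\mathsf Q$ denotes Robinson arithmetic in the language $(0, S, +, \cdot, \leqslant)$ (with $x \leqslant y \leftrightarrow \exists r (r + x = y)$ as an axiom). $\mathsf I(=)$ is $\mathsf Q$ together with the induction schema for all formulas of the form $t = s$ ($t,s$ terms, possibly with parameters); $\mathsf I(\leqslant)$ and $\mathsf I(\not\leqslant)$ are defined similarly with induction for formulas $t \leqslant s$ and $\neg(t \leqslant s)$ respectively. -}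

module Defs where

open import Data.Nat using (ℕ; zero; suc; _≥_)
open import Data.Fin using (Fin; zero; suc)
open import Data.List using (List; []; _∷_; map)
open import Data.List.Membership.Propositional using (_∈_)
open import Data.Product using (Σ; _×_; _,_)
open import Data.Sum using (_⊎_)
open import Relation.Binary.PropositionalEquality using (_≡_)

-- Syntax (de Bruijn variables: Term n / Form n have n free variables)

infixl 7 _·_
infixl 6 _⊕_
infix  4 _≐_ _≼_
infixr 2 _⇒_

data Term (n : ℕ) : Set where
  var  : Fin n → Term n
  𝟎    : Term n
  S    : Term n → Term n
  _⊕_  : Term n → Term n → Term n
  _·_  : Term n → Term n → Term n

data Form (n : ℕ) : Set where
  _≐_  : Term n → Term n → Form n
  _≼_  : Term n → Term n → Form n
  ⊥'   : Form n
  _⇒_  : Form n → Form n → Form n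
  ∀'   : Form (suc n) → Form n

¬' : ∀ {n} → Form n → Form n
¬' φ = φ ⇒ ⊥'

infixr 3 _∧'_
_∧'_ : ∀ {n} → Form n → Form n → Form n
φ ∧' ψ = ¬' (φ ⇒ ¬' ψ)

_⇔'_ : ∀ {n} → Form n → Form n → Form n
φ ⇔' ψ = (φ ⇒ ψ) ∧' (ψ ⇒ φ)

∃' : ∀ {n} → Form (suc n) → Form n
∃' φ = ¬' (∀' (¬' φ))

liftR : ∀ {m n} → (Fin m → Fin n) → Fin (suc m) → Fin (suc n)
liftR ρ zero    = zero
liftR ρ (suc i) = suc (ρ i)

renT : ∀ {m n} → (Fin m → Fin n) → Term m → Term n
renT ρ (var i) = var (ρ i)
renT ρ 𝟎       = 𝟎
renT ρ (S t)   = S (renT ρ t)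
renT ρ (t ⊕ s) = renT ρ t ⊕ renT ρ s
renT ρ (t · s) = renT ρ t · renT ρ s

renF : ∀ {m n} → (Fin m → Fin n) → Form m → Form n
renF ρ (t ≐ s) = renT ρ t ≐ renT ρ s
renF ρ (t ≼ s) = renT ρ t ≼ renT ρ s
renF ρ ⊥'      = ⊥'
renF ρ (φ ⇒ ψ) = renF ρ φ ⇒ renF ρ ψ
renF ρ (∀' φ)  = ∀' (renF (liftR ρ) φ)

liftS : ∀ {m n} → (Fin m → Term n) → Fin (suc m) → Term (suc n)
liftS σ zero    = var zero
liftS σ (suc i) = renT suc (σ i)

subT : ∀ {m n} → (Fin m → Term n) → Term m → Term n
subT σ (var i) = σ i
subT σ 𝟎       = 𝟎
subT σ (S t)   = S (subT σ t)
subT σ (t ⊕ s) = subT σ t ⊕ subT σ s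
subT σ (t · s) = subT σ t · subT σ s

subF : ∀ {m n} → (Fin m → Term n) → Form m → Form n
subF σ (t ≐ s) = subT σ t ≐ subT σ s
subF σ (t ≼ s) = subT σ t ≼ subT σ s
subF σ ⊥'      = ⊥'
subF σ (φ ⇒ ψ) = subF σ φ ⇒ subF σ ψ
subF σ (∀' φ)  = ∀' (subF (liftS σ) φ)

inst : ∀ {n} → Term n → Fin (suc n) → Term n
inst t zero    = t
inst t (suc i) = var i

_[_] : ∀ {n} → Form (suc n) → Term n → Form n
φ [ t ] = subF (inst t) φ

closedF : ∀ {n} → Form 0 → Form n
closedF = renF (λ ())

wkF : ∀ {n} → Form n → Form (suc n)
wkF = renF suc

Theory : Set₁
Theory = Form 0 → Set

data _⨾_⊢_ (T : Theory) {n : ℕ} : List (Form n) → Form n → Set where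
  hyp   : ∀ {Γ φ} → φ ∈ Γ → T ⨾ Γ ⊢ φ
  ax    : ∀ {Γ} {φ : Form 0} → T φ → T ⨾ Γ ⊢ closedF φ
  ⇒I    : ∀ {Γ φ ψ} → T ⨾ (φ ∷ Γ) ⊢ ψ → T ⨾ Γ ⊢ (φ ⇒ ψ)
  ⇒E    : ∀ {Γ φ ψ} → T ⨾ Γ ⊢ (φ ⇒ ψ) → T ⨾ Γ ⊢ φ → T ⨾ Γ ⊢ ψ
  raa   : ∀ {Γ φ} → T ⨾ (¬' φ ∷ Γ) ⊢ ⊥' → T ⨾ Γ ⊢ φ
  ∀I    : ∀ {Γ} {φ : Form (suc n)} → _⨾_⊢_ T {suc n} (map wkF Γ) φ → T ⨾ Γ ⊢ ∀' φ
  ∀E    : ∀ {Γ} {φ : Form (suc n)} → T ⨾ Γ ⊢ ∀' φ → (t : Term n) → T ⨾ Γ ⊢ (φ [ t ])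
  ≐refl : ∀ {Γ} (t : Term n) → T ⨾ Γ ⊢ (t ≐ t)
  ≐subst : ∀ {Γ} (φ : Form (suc n)) {t s : Term n} →
           T ⨾ Γ ⊢ (t ≐ s) → T ⨾ Γ ⊢ (φ [ t ]) → T ⨾ Γ ⊢ (φ [ s ])

_⊢_ : Theory → Form 0 → Set
T ⊢ φ = _⨾_⊢_ T {0} [] φ

_⊢Th_ : Theory → Theory → Set
T₁ ⊢Th T₂ = ∀ φ → T₂ φ → T₁ ⊢ φ

x₀ x₁ x₂ : ∀ {n} → Term (suc (suc (suc n)))
x₀ = var zero
x₁ = var (suc zero)
x₂ = var (suc (suc zero))

v0 : ∀ {n} → Term (suc n)
v0 = var zero
v1 : ∀ {n} → Term (suc (suc n))
v1 = var (suc zero)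

data QAx : Theory where
  q1 : QAx (∀' (¬' (S v0 ≐ 𝟎)))
  q2 : QAx (∀' (∀' ((S v1 ≐ S v0) ⇒ (v1 ≐ v0))))
  q3 : QAx (∀' (¬' (v0 ≐ 𝟎) ⇒ ∃' (v1 ≐ S v0)))
  q4 : QAx (∀' (v0 ⊕ 𝟎 ≐ v0))
  q5 : QAx (∀' (∀' (v1 ⊕ S v0 ≐ S (v1 ⊕ v0))))
  q6 : QAx (∀' (v0 · 𝟎 ≐ 𝟎))
  q7 : QAx (∀' (∀' (v1 · S v0 ≐ (v1 · v0) ⊕ v1)))
  -- ∀x ∀y (x ≤ y ↔ ∃r (r + x = y))
  q8 : QAx (∀' (∀' ((v1 ≼ v0) ⇔' ∃' ((x₀ ⊕ x₂) ≐ x₁))))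

closeAll : (k : ℕ) → Form k → Form 0
closeAll zero    φ = φ
closeAll (suc k) φ = closeAll k (∀' φ)

-- φ has the induction variable x as variable 0 and k parameters
stepSub : ∀ {k} → Fin (suc k) → Term (suc k)
stepSub zero    = S (var zero)
stepSub (suc i) = var (suc i)

indInstance : ∀ {k} → Form (suc k) → Form k
indInstance φ = ((φ [ 𝟎 ]) ∧' ∀' (φ ⇒ subF stepSub φ)) ⇒ ∀' φ

data IndTheory (P : ∀ {k} → Form (suc k) → Set) : Theory where
  base : ∀ {φ} → QAx φ → IndTheory P φ
  ind  : ∀ {k} (φ : Form (suc k)) → P φ → IndTheory P (closeAll k (indInstance φ))

data IsEq {k : ℕ} : Form (suc k) → Set where
  isEq : (t s : Term (suc k)) → IsEq (t ≐ s)

data IsLe {k : ℕ} : Form (suc k) → Set where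
  isLe : (t s : Term (suc k)) → IsLe (t ≼ s)

data IsNLe {k : ℕ} : Form (suc k) → Set where
  isNLe : (t s : Term (suc k)) → IsNLe (¬' (t ≼ s))

I= I≤ I≰ : Theory
I= = IndTheory IsEq
I≤ = IndTheory IsLe
I≰ = IndTheory IsNLe

_^'_ : ∀ {n} → Term n → ℕ → Term n
t ^' zero  = S 𝟎
t ^' suc r = (t ^' r) · t

rootSentence : ℕ → Form 0
rootSentence r = ∀' (∃' ((v0 ^' r ≼ v1) ∧' ¬' (S v0 ^' r ≼ v1)))

{-# OPTIONS --safe #-}
module Submission where

-- 𝔇 consists of the standard numbers, a ℤ-chain of nonstandard elements above them, and a
-- point ω absorbing every sum or product that leaves the chain; it satisfies Q.  Every
-- element lies below ω, so ω has no r-th root, and ω lies below ω only, which breaks induction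
-- for x + x ≤ p (p on the chain) and for ¬ ω ≤ x.  The work is to show that 𝔇 satisfies
-- equality induction: an equation between terms that holds at every standard number holds
-- everywhere.  After translating the chain so that all parameters and x are nonnegative, the
-- chain element a is matched with the standard number N + a, and ω with numbers ≥ 2N.  This
-- matching is respected by S, + and ·, and for N above the sizes of the two values at x it is
-- injective on them, so the equation at the standard point N + a (or 2N) transfers back.

open import Defs
open import Data.Empty using (⊥; ⊥-elim)
open import Data.Fin using (Fin; zero; suc)
open import Data.Integer as ℤ using (ℤ; +_; -[1+_])
import Data.Integer.Properties as ℤₚ
open import Algebra.Properties.AbelianGroup ℤₚ.+-0-abelianGroup
  using (∙-cancelˡ; ∙-cancelʳ; //-rightDividesˡ)
open import Algebra.Properties.CommutativeSemigroup ℤₚ.+-commutativeSemigroup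
  using (x∙yz≈y∙xz; xy∙z≈xz∙y)
open import Data.List.Relation.Unary.All as All using (All; []; _∷_)
import Data.List.Relation.Unary.All.Properties as All
open import Data.Nat as ℕ using (ℕ; zero; suc; _≤_; _<_; _≥_; s≤s)
import Data.Nat.Properties as ℕₚ
open import Data.Product using (_×_; _,_; proj₁; proj₂; ∃-syntax)
open import Data.Unit using (⊤; tt)
open import Function using (id; _∘_; _⇔_; mk⇔; Equivalence)
open import Function.Construct.Identity using (⇔-id)
open import Function.Related.TypeIsomorphisms using (→-cong-⇔)
open import Relation.Binary.Definitions using (DecidableEquality)
open import Relation.Binary.PropositionalEquality
  using (_≡_; _≢_; refl; sym; trans; cong; cong₂; subst; subst₂; module ≡-Reasoning)
open import Relation.Nullary using (¬_; Stable; yes; no)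
import Relation.Nullary.Decidable as Dec
open import Relation.Nullary.Decidable using (decidable-stable)
open import Relation.Nullary.Negation using (negated-stable)

record Structure : Set₁ where
  field
    Carrier : Set
    zero′   : Carrier
    suc′    : Carrier → Carrier
    _+′_    : Carrier → Carrier → Carrier
    _*′_    : Carrier → Carrier → Carrier
    _≟_     : DecidableEquality Carrier

module Semantics (𝔄 : Structure) where
  open Structure 𝔄

  Env : ℕ → Set
  Env n = Fin n → Carrier

  infixl 5 _▷_
  _▷_ : ∀ {n} → Env n → Carrier → Env (suc n)
  (ρ ▷ d) zero    = d
  (ρ ▷ d) (suc i) = ρ i

  ⟦_⟧ₜ : ∀ {n} → Term n → Env n → Carrier
  ⟦ var i ⟧ₜ ρ = ρ i
  ⟦ 𝟎 ⟧ₜ     ρ = zero′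
  ⟦ S t ⟧ₜ   ρ = suc′ (⟦ t ⟧ₜ ρ)
  ⟦ t ⊕ s ⟧ₜ ρ = ⟦ t ⟧ₜ ρ +′ ⟦ s ⟧ₜ ρ
  ⟦ t · s ⟧ₜ ρ = ⟦ t ⟧ₜ ρ *′ ⟦ s ⟧ₜ ρ

  infix 4 _≤′_
  -- the meaning fixed by the axiom q8, with its existential read classically
  _≤′_ : Carrier → Carrier → Set
  a ≤′ b = ¬ (∀ r → r +′ a ≢ b)

  ⟦_⟧ : ∀ {n} → Form n → Env n → Set
  ⟦ t ≐ s ⟧ ρ = ⟦ t ⟧ₜ ρ ≡ ⟦ s ⟧ₜ ρ
  ⟦ t ≼ s ⟧ ρ = ⟦ t ⟧ₜ ρ ≤′ ⟦ s ⟧ₜ ρ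
  ⟦ ⊥' ⟧    ρ = ⊥
  ⟦ φ ⇒ ψ ⟧ ρ = ⟦ φ ⟧ ρ → ⟦ ψ ⟧ ρ
  ⟦ ∀' φ ⟧  ρ = ∀ d → ⟦ φ ⟧ (ρ ▷ d)

  ⟦⟧-stable : ∀ {n} (φ : Form n) ρ → Stable (⟦ φ ⟧ ρ)
  ⟦⟧-stable (t ≐ s) ρ = decidable-stable (⟦ t ⟧ₜ ρ ≟ ⟦ s ⟧ₜ ρ)
  ⟦⟧-stable (t ≼ s) ρ = negated-stable
  ⟦⟧-stable ⊥'      ρ ¬¬⊥ = ¬¬⊥ id
  ⟦⟧-stable (φ ⇒ ψ) ρ ¬¬f a = ⟦⟧-stable ψ ρ (λ ¬b → ¬¬f (λ f → ¬b (f a)))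
  ⟦⟧-stable (∀' φ)  ρ ¬¬f d = ⟦⟧-stable φ (ρ ▷ d) (λ ¬b → ¬¬f (λ f → ¬b (f d)))

  ⟦∧'⟧ : ∀ {n} (φ ψ : Form n) ρ → ⟦ φ ∧' ψ ⟧ ρ → ⟦ φ ⟧ ρ × ⟦ ψ ⟧ ρ
  ⟦∧'⟧ φ ψ ρ φ∧ψ = ⟦⟧-stable φ ρ (λ ¬a → φ∧ψ (λ a _ → ¬a a))
                 , ⟦⟧-stable ψ ρ (λ ¬b → φ∧ψ (λ _ b → ¬b b))

  cong₂-⇔ : ∀ (R : Carrier → Carrier → Set) {a a′ b b′} → a ≡ a′ → b ≡ b′ → R a b ⇔ R a′ b′
  cong₂-⇔ R refl refl = ⇔-id _

  ∀'-cong-⇔ : ∀ {A : Carrier → Set} {B : Carrier → Set} →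
              (∀ d → A d ⇔ B d) → (∀ d → A d) ⇔ (∀ d → B d)
  ∀'-cong-⇔ A⇔B = mk⇔ (λ f d → Equivalence.to (A⇔B d) (f d))
                      (λ f d → Equivalence.from (A⇔B d) (f d))

  ⟦⟧ₜ-rename : ∀ {m n} (r : Fin m → Fin n) {ρ : Env n} {ρ′ : Env m} →
               (∀ i → ρ (r i) ≡ ρ′ i) → ∀ t → ⟦ renT r t ⟧ₜ ρ ≡ ⟦ t ⟧ₜ ρ′
  ⟦⟧ₜ-rename r h (var i) = h i
  ⟦⟧ₜ-rename r h 𝟎       = refl
  ⟦⟧ₜ-rename r h (S t)   = cong suc′ (⟦⟧ₜ-rename r h t)
  ⟦⟧ₜ-rename r h (t ⊕ s) = cong₂ _+′_ (⟦⟧ₜ-rename r h t) (⟦⟧ₜ-rename r h s)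
  ⟦⟧ₜ-rename r h (t · s) = cong₂ _*′_ (⟦⟧ₜ-rename r h t) (⟦⟧ₜ-rename r h s)

  ⟦⟧-rename : ∀ {m n} (r : Fin m → Fin n) {ρ : Env n} {ρ′ : Env m} →
              (∀ i → ρ (r i) ≡ ρ′ i) → ∀ φ → ⟦ renF r φ ⟧ ρ ⇔ ⟦ φ ⟧ ρ′
  ⟦⟧-rename r h (t ≐ s) = cong₂-⇔ _≡_  (⟦⟧ₜ-rename r h t) (⟦⟧ₜ-rename r h s)
  ⟦⟧-rename r h (t ≼ s) = cong₂-⇔ _≤′_ (⟦⟧ₜ-rename r h t) (⟦⟧ₜ-rename r h s)
  ⟦⟧-rename r h ⊥'      = ⇔-id _
  ⟦⟧-rename r h (φ ⇒ ψ) = →-cong-⇔ (⟦⟧-rename r h φ) (⟦⟧-rename r h ψ)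
  ⟦⟧-rename r h (∀' φ)  = ∀'-cong-⇔ λ d → ⟦⟧-rename (liftR r) (lifted d) φ
    where
    lifted : ∀ d i → (_ ▷ d) (liftR r i) ≡ (_ ▷ d) i
    lifted d zero    = refl
    lifted d (suc i) = h i

  ⟦⟧ₜ-subst : ∀ {m n} (σ : Fin m → Term n) {ρ : Env n} {ρ′ : Env m} →
              (∀ i → ⟦ σ i ⟧ₜ ρ ≡ ρ′ i) → ∀ t → ⟦ subT σ t ⟧ₜ ρ ≡ ⟦ t ⟧ₜ ρ′
  ⟦⟧ₜ-subst σ h (var i) = h i
  ⟦⟧ₜ-subst σ h 𝟎       = refl
  ⟦⟧ₜ-subst σ h (S t)   = cong suc′ (⟦⟧ₜ-subst σ h t)
  ⟦⟧ₜ-subst σ h (t ⊕ s) = cong₂ _+′_ (⟦⟧ₜ-subst σ h t) (⟦⟧ₜ-subst σ h s)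
  ⟦⟧ₜ-subst σ h (t · s) = cong₂ _*′_ (⟦⟧ₜ-subst σ h t) (⟦⟧ₜ-subst σ h s)

  ⟦⟧-subst : ∀ {m n} (σ : Fin m → Term n) {ρ : Env n} {ρ′ : Env m} →
             (∀ i → ⟦ σ i ⟧ₜ ρ ≡ ρ′ i) → ∀ φ → ⟦ subF σ φ ⟧ ρ ⇔ ⟦ φ ⟧ ρ′
  ⟦⟧-subst σ h (t ≐ s) = cong₂-⇔ _≡_  (⟦⟧ₜ-subst σ h t) (⟦⟧ₜ-subst σ h s)
  ⟦⟧-subst σ h (t ≼ s) = cong₂-⇔ _≤′_ (⟦⟧ₜ-subst σ h t) (⟦⟧ₜ-subst σ h s)
  ⟦⟧-subst σ h ⊥'      = ⇔-id _
  ⟦⟧-subst σ h (φ ⇒ ψ) = →-cong-⇔ (⟦⟧-subst σ h φ) (⟦⟧-subst σ h ψ)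
  ⟦⟧-subst σ {ρ} h (∀' φ) = ∀'-cong-⇔ λ d → ⟦⟧-subst (liftS σ) (lifted d) φ
    where
    lifted : ∀ d i → ⟦ liftS σ i ⟧ₜ (ρ ▷ d) ≡ (_ ▷ d) i
    lifted d zero    = refl
    lifted d (suc i) = trans (⟦⟧ₜ-rename suc (λ _ → refl) (σ i)) (h i)

  ⟦⟧-inst : ∀ {n} (φ : Form (suc n)) (t : Term n) ρ → ⟦ φ [ t ] ⟧ ρ ⇔ ⟦ φ ⟧ (ρ ▷ ⟦ t ⟧ₜ ρ)
  ⟦⟧-inst φ t ρ = ⟦⟧-subst (inst t) instantiated φ
    where
    instantiated : ∀ i → ⟦ inst t i ⟧ₜ ρ ≡ (ρ ▷ ⟦ t ⟧ₜ ρ) i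
    instantiated zero    = refl
    instantiated (suc i) = refl

  ⟦⟧-stepSub : ∀ {k} (φ : Form (suc k)) ρ d → ⟦ subF stepSub φ ⟧ (ρ ▷ d) ⇔ ⟦ φ ⟧ (ρ ▷ suc′ d)
  ⟦⟧-stepSub φ ρ d = ⟦⟧-subst stepSub stepped φ
    where
    stepped : ∀ i → ⟦ stepSub i ⟧ₜ (ρ ▷ d) ≡ (ρ ▷ suc′ d) i
    stepped zero    = refl
    stepped (suc i) = refl

  IsModel : Theory → Set
  IsModel T = ∀ φ → T φ → ⟦ φ ⟧ (λ ())

  soundness : ∀ {T n Γ φ} → IsModel T → _⨾_⊢_ T {n} Γ φ →
              ∀ ρ → All (λ γ → ⟦ γ ⟧ ρ) Γ → ⟦ φ ⟧ ρ
  soundness M (hyp γ∈Γ) ρ Γ-true = All.lookup Γ-true γ∈Γ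
  soundness M (ax {φ = φ} Tφ) ρ Γ-true = Equivalence.from (⟦⟧-rename (λ ()) (λ ()) φ) (M φ Tφ)
  soundness M (⇒I d) ρ Γ-true a = soundness M d ρ (a ∷ Γ-true)
  soundness M (⇒E d e) ρ Γ-true = soundness M d ρ Γ-true (soundness M e ρ Γ-true)
  soundness M (raa {φ = φ} d) ρ Γ-true = ⟦⟧-stable φ ρ (λ ¬a → soundness M d ρ (¬a ∷ Γ-true))
  soundness M (∀I {Γ = Γ} d) ρ Γ-true e = soundness M d (ρ ▷ e) (All.map⁺ (All.map weakened Γ-true))
    where
    weakened : ∀ {γ} → ⟦ γ ⟧ ρ → ⟦ wkF γ ⟧ (ρ ▷ e)
    weakened {γ} = Equivalence.from (⟦⟧-rename suc (λ _ → refl) γ)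
  soundness M (∀E {φ = φ} d t) ρ Γ-true =
    Equivalence.from (⟦⟧-inst φ t ρ) (soundness M d ρ Γ-true (⟦ t ⟧ₜ ρ))
  soundness M (≐refl t) ρ Γ-true = refl
  soundness M (≐subst φ {t} {s} t≐s d) ρ Γ-true =
    Equivalence.from (⟦⟧-inst φ s ρ)
      (subst (λ v → ⟦ φ ⟧ (ρ ▷ v)) (soundness M t≐s ρ Γ-true)
        (Equivalence.to (⟦⟧-inst φ t ρ) (soundness M d ρ Γ-true)))

  unprovable : ∀ {T φ} → IsModel T → ¬ ⟦ φ ⟧ (λ ()) → ¬ (T ⊢ φ)
  unprovable M ¬φ d = ¬φ (soundness M d (λ ()) [])

  numeral : ℕ → Carrier
  numeral zero    = zero′
  numeral (suc n) = suc′ (numeral n)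

  ⟦⟧-closeAll : ∀ k (φ : Form k) → (∀ ρ → ⟦ φ ⟧ ρ) → ⟦ closeAll k φ ⟧ (λ ())
  ⟦⟧-closeAll zero    φ φ-true = φ-true (λ ())
  ⟦⟧-closeAll (suc k) φ φ-true = ⟦⟧-closeAll k (∀' φ) (λ ρ d → φ-true (ρ ▷ d))

  ⟦⟧-indInstance : ∀ {k} (φ : Form (suc k)) ρ →
                   ((∀ n → ⟦ φ ⟧ (ρ ▷ numeral n)) → ∀ d → ⟦ φ ⟧ (ρ ▷ d)) →
                   ⟦ indInstance φ ⟧ ρ
  ⟦⟧-indInstance φ ρ transfer premises = transfer at-numerals
    where
    base-and-step = ⟦∧'⟧ (φ [ 𝟎 ]) (∀' (φ ⇒ subF stepSub φ)) ρ premises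
    at-numerals : ∀ n → ⟦ φ ⟧ (ρ ▷ numeral n)
    at-numerals zero    = Equivalence.to (⟦⟧-inst φ 𝟎 ρ) (proj₁ base-and-step)
    at-numerals (suc n) =
      Equivalence.to (⟦⟧-stepSub φ ρ _) (proj₂ base-and-step (numeral n) (at-numerals n))

  IndTheory-model : ∀ {P : ∀ {k} → Form (suc k) → Set} → IsModel QAx →
                    (∀ {k} (φ : Form (suc k)) → P φ → ∀ ρ →
                       (∀ n → ⟦ φ ⟧ (ρ ▷ numeral n)) → ∀ d → ⟦ φ ⟧ (ρ ▷ d)) →
                    IsModel (IndTheory P)
  IndTheory-model Q-model transfer _ (base q)      = Q-model _ q
  IndTheory-model Q-model transfer _ (ind {k} φ Pφ) =
    ⟦⟧-closeAll k (indInstance φ) (λ ρ → ⟦⟧-indInstance φ ρ (transfer φ Pφ ρ))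

data D : Set where
  std : ℕ → D
  nst : ℤ → D
  ω   : D

sucᴰ : D → D
sucᴰ (std n) = std (suc n)
sucᴰ (nst j) = nst (ℤ.suc j)
sucᴰ ω       = ω

infixl 6 _+ᴰ_
infixl 7 _*ᴰ_

_+ᴰ_ : D → D → D
std m +ᴰ std n = std (m ℕ.+ n)
std m +ᴰ nst j = nst (j ℤ.+ + m)
nst j +ᴰ std n = nst (j ℤ.+ + n)
_     +ᴰ _     = ω

scale : ℕ → D → D
scale zero          y = std 0
scale (suc zero)    y = y
scale (suc (suc m)) y = ω

_*ᴰ_ : D → D → D
std m *ᴰ std n = std (m ℕ.* n)
std m *ᴰ y     = scale m y
x     *ᴰ std n = scale n x
_     *ᴰ _     = ω

std-injective : ∀ {m n} → std m ≡ std n → m ≡ n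
std-injective refl = refl

nst-injective : ∀ {i j} → nst i ≡ nst j → i ≡ j
nst-injective refl = refl

_≟ᴰ_ : DecidableEquality D
std m ≟ᴰ std n = Dec.map′ (cong std) std-injective (m ℕ.≟ n)
nst i ≟ᴰ nst j = Dec.map′ (cong nst) nst-injective (i ℤ.≟ j)
ω     ≟ᴰ ω     = yes refl
std _ ≟ᴰ nst _ = no λ ()
std _ ≟ᴰ ω     = no λ ()
nst _ ≟ᴰ std _ = no λ ()
nst _ ≟ᴰ ω     = no λ ()
ω     ≟ᴰ std _ = no λ ()
ω     ≟ᴰ nst _ = no λ ()

𝔇 : Structure
𝔇 = record
  { Carrier = D ; zero′ = std 0 ; suc′ = sucᴰ ; _+′_ = _+ᴰ_ ; _*′_ = _*ᴰ_ ; _≟_ = _≟ᴰ_ }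

open Semantics 𝔇

sucᴰ≢0 : ∀ x → sucᴰ x ≢ std 0
sucᴰ≢0 (std _) ()
sucᴰ≢0 (nst _) ()
sucᴰ≢0 ω       ()

sucᴰ-injective : ∀ x y → sucᴰ x ≡ sucᴰ y → x ≡ y
sucᴰ-injective (std m) (std .m) refl = refl
sucᴰ-injective (nst i) (nst j) e     = cong nst (∙-cancelˡ (+ 1) i j (nst-injective e))
sucᴰ-injective ω       ω       _     = refl
sucᴰ-injective (std _) (nst _) ()
sucᴰ-injective (std _) ω       ()
sucᴰ-injective (nst _) (std _) ()
sucᴰ-injective (nst _) ω       ()
sucᴰ-injective ω       (std _) ()
sucᴰ-injective ω       (nst _) ()

sucᴰ-surjective : ∀ x → x ≢ std 0 → ∃[ y ] x ≡ sucᴰ y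
sucᴰ-surjective (std zero)    x≢0 = ⊥-elim (x≢0 refl)
sucᴰ-surjective (std (suc n)) _   = std n , refl
sucᴰ-surjective (nst j)       _   = nst (ℤ.pred j) , cong nst (sym (ℤₚ.suc-pred j))
sucᴰ-surjective ω             _   = ω , refl

+ᴰ-identityʳ : ∀ x → x +ᴰ std 0 ≡ x
+ᴰ-identityʳ (std m) = cong std (ℕₚ.+-identityʳ m)
+ᴰ-identityʳ (nst j) = cong nst (ℤₚ.+-identityʳ j)
+ᴰ-identityʳ ω       = refl

+ᴰ-suc : ∀ x y → x +ᴰ sucᴰ y ≡ sucᴰ (x +ᴰ y)
+ᴰ-suc (std m) (std n) = cong std (ℕₚ.+-suc m n)
+ᴰ-suc (std m) (nst j) = cong nst (ℤₚ.+-assoc (+ 1) j (+ m))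
+ᴰ-suc (nst j) (std n) = cong nst (x∙yz≈y∙xz j (+ 1) (+ n))
+ᴰ-suc (std _) ω       = refl
+ᴰ-suc (nst _) (nst _) = refl
+ᴰ-suc (nst _) ω       = refl
+ᴰ-suc ω       _       = refl

*ᴰ-zeroʳ : ∀ x → x *ᴰ std 0 ≡ std 0
*ᴰ-zeroʳ (std m) = cong std (ℕₚ.*-zeroʳ m)
*ᴰ-zeroʳ (nst _) = refl
*ᴰ-zeroʳ ω       = refl

scale-suc : ∀ m j → scale m (nst (ℤ.suc j)) ≡ scale m (nst j) +ᴰ std m
scale-suc zero          j = refl
scale-suc (suc zero)    j = cong nst (ℤₚ.+-comm (+ 1) j)
scale-suc (suc (suc m)) j = refl

scale-ω : ∀ m → scale m ω ≡ scale m ω +ᴰ std m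
scale-ω zero          = refl
scale-ω (suc zero)    = refl
scale-ω (suc (suc m)) = refl

*ᴰ-suc : ∀ x y → x *ᴰ sucᴰ y ≡ x *ᴰ y +ᴰ x
*ᴰ-suc (std m) (std n) = cong std (trans (ℕₚ.*-suc m n) (ℕₚ.+-comm m (m ℕ.* n)))
*ᴰ-suc (std m) (nst j) = scale-suc m j
*ᴰ-suc (std m) ω       = scale-ω m
*ᴰ-suc (nst j) (std zero)          = cong nst (sym (ℤₚ.+-identityʳ j))
*ᴰ-suc (nst _) (std (suc zero))    = refl
*ᴰ-suc (nst _) (std (suc (suc _))) = refl
*ᴰ-suc ω       (std zero)          = refl
*ᴰ-suc ω       (std (suc zero))    = refl
*ᴰ-suc ω       (std (suc (suc _))) = refl
*ᴰ-suc (nst _) (nst _) = refl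
*ᴰ-suc (nst _) ω       = refl
*ᴰ-suc ω       (nst _) = refl
*ᴰ-suc ω       ω       = refl

𝔇-Q : IsModel QAx
𝔇-Q _ q1 = sucᴰ≢0
𝔇-Q _ q2 = sucᴰ-injective
𝔇-Q _ q3 x x≢0 no-pred = let (y , x≡sy) = sucᴰ-surjective x x≢0 in no-pred y x≡sy
𝔇-Q _ q4 = +ᴰ-identityʳ
𝔇-Q _ q5 = +ᴰ-suc
𝔇-Q _ q6 = *ᴰ-zeroʳ
𝔇-Q _ q7 = *ᴰ-suc
𝔇-Q _ q8 _ _ ≤⇔∃ = ≤⇔∃ id id

+ᴰ-comm : ∀ x y → x +ᴰ y ≡ y +ᴰ x
+ᴰ-comm (std m) (std n) = cong std (ℕₚ.+-comm m n)
+ᴰ-comm (std _) (nst _) = refl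
+ᴰ-comm (std _) ω       = refl
+ᴰ-comm (nst _) (std _) = refl
+ᴰ-comm (nst _) (nst _) = refl
+ᴰ-comm (nst _) ω       = refl
+ᴰ-comm ω       (std _) = refl
+ᴰ-comm ω       (nst _) = refl
+ᴰ-comm ω       ω       = refl

+ᴰ-ωʳ : ∀ x → x +ᴰ ω ≡ ω
+ᴰ-ωʳ (std _) = refl
+ᴰ-ωʳ (nst _) = refl
+ᴰ-ωʳ ω       = refl

*ᴰ-comm : ∀ x y → x *ᴰ y ≡ y *ᴰ x
*ᴰ-comm (std m) (std n) = cong std (ℕₚ.*-comm m n)
*ᴰ-comm (std _) (nst _) = refl
*ᴰ-comm (std _) ω       = refl
*ᴰ-comm (nst _) (std _) = refl
*ᴰ-comm (nst _) (nst _) = refl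
*ᴰ-comm (nst _) ω       = refl
*ᴰ-comm ω       (std _) = refl
*ᴰ-comm ω       (nst _) = refl
*ᴰ-comm ω       ω       = refl

*ᴰ-zeroˡ : ∀ x → std 0 *ᴰ x ≡ std 0
*ᴰ-zeroˡ (std _) = refl
*ᴰ-zeroˡ (nst _) = refl
*ᴰ-zeroˡ ω       = refl

*ᴰ-ωʳ : ∀ x → x ≢ std 0 → x *ᴰ ω ≡ ω
*ᴰ-ωʳ (std zero)          x≢0 = ⊥-elim (x≢0 refl)
*ᴰ-ωʳ (std (suc zero))    _   = refl
*ᴰ-ωʳ (std (suc (suc _))) _   = refl
*ᴰ-ωʳ (nst _)             _   = refl
*ᴰ-ωʳ ω                   _   = refl

NonNeg : D → Set
NonNeg (nst -[1+ _ ]) = ⊥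
NonNeg _              = ⊤

NonNeg-sucᴰ : ∀ x → NonNeg x → NonNeg (sucᴰ x)
NonNeg-sucᴰ (std _)     _ = tt
NonNeg-sucᴰ (nst (+ _)) _ = tt
NonNeg-sucᴰ ω           _ = tt

NonNeg-+ᴰ : ∀ x y → NonNeg x → NonNeg y → NonNeg (x +ᴰ y)
NonNeg-+ᴰ (std _)          (std _)          _ _ = tt
NonNeg-+ᴰ (std _)          (nst (+ _))      _ _ = tt
NonNeg-+ᴰ (nst (+ _))      (std _)          _ _ = tt
NonNeg-+ᴰ (std _)          (nst -[1+ _ ])   _ ()
NonNeg-+ᴰ (nst -[1+ _ ])   (std _)          () _
NonNeg-+ᴰ (std _)          ω                _ _ = tt
NonNeg-+ᴰ (nst _)          (nst _)          _ _ = tt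
NonNeg-+ᴰ (nst _)          ω                _ _ = tt
NonNeg-+ᴰ ω                _                _ _ = tt

NonNeg-scale : ∀ m y → NonNeg y → NonNeg (scale m y)
NonNeg-scale zero          _ _   = tt
NonNeg-scale (suc zero)    _ y≥0 = y≥0
NonNeg-scale (suc (suc _)) _ _   = tt

NonNeg-*ᴰ : ∀ x y → NonNeg x → NonNeg y → NonNeg (x *ᴰ y)
NonNeg-*ᴰ (std _) (std _) _   _   = tt
NonNeg-*ᴰ (std m) (nst j) _   y≥0 = NonNeg-scale m (nst j) y≥0
NonNeg-*ᴰ (std m) ω       _   _   = NonNeg-scale m ω tt
NonNeg-*ᴰ (nst j) (std n) x≥0 _   = NonNeg-scale n (nst j) x≥0
NonNeg-*ᴰ ω       (std n) _   _   = NonNeg-scale n ω tt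
NonNeg-*ᴰ (nst _) (nst _) _   _   = tt
NonNeg-*ᴰ (nst _) ω       _   _   = tt
NonNeg-*ᴰ ω       (nst _) _   _   = tt
NonNeg-*ᴰ ω       ω       _   _   = tt

shift : ℕ → D → D
shift c (nst j) = nst (j ℤ.+ + c)
shift c x       = x

shift-injective : ∀ c x y → shift c x ≡ shift c y → x ≡ y
shift-injective c (std _) (std _) e = e
shift-injective c (nst i) (nst j) e = cong nst (∙-cancelʳ (+ c) i j (nst-injective e))
shift-injective c ω       ω       _ = refl
shift-injective c (std _) (nst _) ()
shift-injective c (std _) ω       ()
shift-injective c (nst _) (std _) ()
shift-injective c (nst _) ω       ()
shift-injective c ω       (std _) ()
shift-injective c ω       (nst _) ()

shift-sucᴰ : ∀ c x → shift c (sucᴰ x) ≡ sucᴰ (shift c x)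
shift-sucᴰ c (std _) = refl
shift-sucᴰ c (nst j) = cong nst (ℤₚ.+-assoc (+ 1) j (+ c))
shift-sucᴰ c ω       = refl

shift-+ᴰ : ∀ c x y → shift c (x +ᴰ y) ≡ shift c x +ᴰ shift c y
shift-+ᴰ c (std _) (std _) = refl
shift-+ᴰ c (std m) (nst j) = cong nst (xy∙z≈xz∙y j (+ m) (+ c))
shift-+ᴰ c (nst j) (std n) = cong nst (xy∙z≈xz∙y j (+ n) (+ c))
shift-+ᴰ c (std _) ω       = refl
shift-+ᴰ c (nst _) (nst _) = refl
shift-+ᴰ c (nst _) ω       = refl
shift-+ᴰ c ω       _       = refl

shift-scale : ∀ c m y → shift c (scale m y) ≡ scale m (shift c y)
shift-scale c zero          _ = refl
shift-scale c (suc zero)    _ = refl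
shift-scale c (suc (suc _)) _ = refl

shift-*ᴰ : ∀ c x y → shift c (x *ᴰ y) ≡ shift c x *ᴰ shift c y
shift-*ᴰ c (std _) (std _) = refl
shift-*ᴰ c (std m) (nst j) = shift-scale c m (nst j)
shift-*ᴰ c (std m) ω       = shift-scale c m ω
shift-*ᴰ c (nst j) (std n) = shift-scale c n (nst j)
shift-*ᴰ c ω       (std n) = shift-scale c n ω
shift-*ᴰ c (nst _) (nst _) = refl
shift-*ᴰ c (nst _) ω       = refl
shift-*ᴰ c ω       (nst _) = refl
shift-*ᴰ c ω       ω       = refl

⟦⟧ₜ-shift : ∀ {n} c {ρ ρ′ : Env n} → (∀ i → ρ′ i ≡ shift c (ρ i)) →
            ∀ t → ⟦ t ⟧ₜ ρ′ ≡ shift c (⟦ t ⟧ₜ ρ)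
⟦⟧ₜ-shift c h (var i) = h i
⟦⟧ₜ-shift c h 𝟎       = refl
⟦⟧ₜ-shift c {ρ} h (S t) =
  trans (cong sucᴰ (⟦⟧ₜ-shift c h t)) (sym (shift-sucᴰ c (⟦ t ⟧ₜ ρ)))
⟦⟧ₜ-shift c {ρ} h (t ⊕ s) =
  trans (cong₂ _+ᴰ_ (⟦⟧ₜ-shift c h t) (⟦⟧ₜ-shift c h s)) (sym (shift-+ᴰ c (⟦ t ⟧ₜ ρ) (⟦ s ⟧ₜ ρ)))
⟦⟧ₜ-shift c {ρ} h (t · s) =
  trans (cong₂ _*ᴰ_ (⟦⟧ₜ-shift c h t) (⟦⟧ₜ-shift c h s)) (sym (shift-*ᴰ c (⟦ t ⟧ₜ ρ) (⟦ s ⟧ₜ ρ)))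

depth : D → ℕ
depth (nst -[1+ b ]) = suc b
depth _              = 0

NonNeg-shift : ∀ c x → depth x ≤ c → NonNeg (shift c x)
NonNeg-shift c (std _)        _ = tt
NonNeg-shift c (nst (+ _))    _ = tt
NonNeg-shift c (nst -[1+ _ ]) d≤c rewrite ℤₚ.⊖-≥ d≤c = tt
NonNeg-shift c ω              _ = tt

totalDepth : ∀ {n} → Env n → ℕ
totalDepth {zero}  ρ = 0
totalDepth {suc n} ρ = depth (ρ zero) ℕ.+ totalDepth (ρ ∘ suc)

depth≤totalDepth : ∀ {n} (ρ : Env n) i → depth (ρ i) ≤ totalDepth ρ
depth≤totalDepth ρ zero    = ℕₚ.m≤m+n _ _
depth≤totalDepth ρ (suc i) = ℕₚ.≤-trans (depth≤totalDepth (ρ ∘ suc) i) (ℕₚ.m≤n+m _ _)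

size : D → ℕ
size (std m)     = m
size (nst (+ a)) = a
size _           = 0

module Approximation (k : ℕ) where

  -- N ≥ 2, so that a factor N + a sends the chain to ω, as every standard factor ≥ 2 does in 𝔇.
  N : ℕ
  N = 2 ℕ.+ k

  Large : D → Set
  Large (std m)        = N ℕ.+ N ≤ m
  Large (nst (+ a))    = N ≤ a
  Large (nst -[1+ _ ]) = ⊥
  Large ω              = ⊤

  infix 4 _≈_
  data _≈_ : D → D → Set where
    same  : ∀ {x} → NonNeg x → x ≈ x
    chain : ∀ a → nst (+ a) ≈ std (N ℕ.+ a)
    top   : ∀ {w} → Large w → ω ≈ w

  Large-NonNeg : ∀ w → Large w → NonNeg w
  Large-NonNeg (std _)     _ = tt
  Large-NonNeg (nst (+ _)) _ = tt
  Large-NonNeg ω           _ = tt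

  Large⇒≢0 : ∀ w → Large w → w ≢ std 0
  Large⇒≢0 (std zero) () refl

  ≈-NonNegʳ : ∀ {x w} → x ≈ w → NonNeg w
  ≈-NonNegʳ (same x≥0)   = x≥0
  ≈-NonNegʳ (chain _)    = tt
  ≈-NonNegʳ (top {w} w≫) = Large-NonNeg w w≫

  Large-small : ∀ w → Large w → size w < N → w ≡ ω
  Large-small (std m)     w≫ w<N = ⊥-elim (ℕₚ.<⇒≱ w<N (ℕₚ.≤-trans (ℕₚ.m≤m+n N N) w≫))
  Large-small (nst (+ a)) w≫ w<N = ⊥-elim (ℕₚ.<⇒≱ w<N w≫)
  Large-small ω           _  _   = refl

  Large-sucᴰ : ∀ w → Large w → Large (sucᴰ w)
  Large-sucᴰ (std _)     w≫ = ℕₚ.m≤n⇒m≤1+n w≫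
  Large-sucᴰ (nst (+ _)) w≫ = ℕₚ.m≤n⇒m≤1+n w≫
  Large-sucᴰ ω           _  = tt

  Large-+ᴰ : ∀ x w → NonNeg x → Large w → Large (x +ᴰ w)
  Large-+ᴰ (std m)     (std n)     _ w≫ = ℕₚ.≤-trans w≫ (ℕₚ.m≤n+m n m)
  Large-+ᴰ (nst (+ a)) (std n)     _ w≫ =
    ℕₚ.≤-trans (ℕₚ.m≤m+n N N) (ℕₚ.≤-trans w≫ (ℕₚ.m≤n+m n a))
  Large-+ᴰ (std m)     (nst (+ a)) _ w≫ = ℕₚ.≤-trans w≫ (ℕₚ.m≤m+n a m)
  Large-+ᴰ (std _)     ω           _ _  = tt
  Large-+ᴰ (nst _)     (nst _)     _ _  = tt
  Large-+ᴰ (nst _)     ω           _ _  = tt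
  Large-+ᴰ ω           _           _ _  = tt
  Large-+ᴰ (nst -[1+ _ ]) (std _)  () _

  Large-*ᴰ : ∀ x w → x ≢ std 0 → Large w → Large (x *ᴰ w)
  Large-*ᴰ (std zero)          _           x≢0 _  = ⊥-elim (x≢0 refl)
  Large-*ᴰ (std (suc m))       (std n)     _   w≫ = ℕₚ.≤-trans w≫ (ℕₚ.m≤m+n n (m ℕ.* n))
  Large-*ᴰ (std (suc zero))    (nst (+ _)) _   w≫ = w≫
  Large-*ᴰ (std (suc (suc _))) (nst (+ _)) _   _  = tt
  Large-*ᴰ (std (suc zero))    ω           _   _  = tt
  Large-*ᴰ (std (suc (suc _))) ω           _   _  = tt
  Large-*ᴰ (nst _)             (std (suc (suc _))) _ _ = tt
  Large-*ᴰ ω                   (std (suc (suc _))) _ _ = tt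
  Large-*ᴰ (nst _)             (nst _)     _   _  = tt
  Large-*ᴰ (nst _)             ω           _   _  = tt
  Large-*ᴰ ω                   (nst _)     _   _  = tt
  Large-*ᴰ ω                   ω           _   _  = tt
  Large-*ᴰ (nst _)             (std (suc zero)) _ (s≤s ())
  Large-*ᴰ ω                   (std (suc zero)) _ (s≤s ())

  ≈-sucᴰ : ∀ {x w} → x ≈ w → sucᴰ x ≈ sucᴰ w
  ≈-sucᴰ (same {x} x≥0) = same (NonNeg-sucᴰ x x≥0)
  ≈-sucᴰ (chain a)      = subst (λ n → nst (+ suc a) ≈ std n) (ℕₚ.+-suc N a) (chain (suc a))
  ≈-sucᴰ (top {w} w≫)   = top (Large-sucᴰ w w≫)

  same-+ᴰ-chain : ∀ x → NonNeg x → ∀ a → x +ᴰ nst (+ a) ≈ x +ᴰ std (N ℕ.+ a)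
  same-+ᴰ-chain (std m)        _  a = subst (λ n → nst (+ (a ℕ.+ m)) ≈ std n)
    (trans (sym (ℕₚ.+-assoc N a m)) (ℕₚ.+-comm (N ℕ.+ a) m)) (chain (a ℕ.+ m))
  same-+ᴰ-chain (nst (+ b))    _  a = top (ℕₚ.≤-trans (ℕₚ.m≤m+n N a) (ℕₚ.m≤n+m _ b))
  same-+ᴰ-chain ω              _  a = top tt
  same-+ᴰ-chain (nst -[1+ _ ]) () a

  same-+ᴰ-top : ∀ x → NonNeg x → ∀ {w} → Large w → x +ᴰ ω ≈ x +ᴰ w
  same-+ᴰ-top x x≥0 {w} w≫ = subst (_≈ x +ᴰ w) (sym (+ᴰ-ωʳ x)) (top (Large-+ᴰ x w x≥0 w≫))

  ≈-+ᴰ : ∀ {x₁ w₁ x₂ w₂} → x₁ ≈ w₁ → x₂ ≈ w₂ → x₁ +ᴰ x₂ ≈ w₁ +ᴰ w₂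
  ≈-+ᴰ (same {x} x≥0) (same {y} y≥0) = same (NonNeg-+ᴰ x y x≥0 y≥0)
  ≈-+ᴰ (same {x} x≥0) (chain a)      = same-+ᴰ-chain x x≥0 a
  ≈-+ᴰ (same {x} x≥0) (top w≫)       = same-+ᴰ-top x x≥0 w≫
  ≈-+ᴰ (chain a)      (same {y} y≥0) =
    subst₂ _≈_ (+ᴰ-comm y _) (+ᴰ-comm y _) (same-+ᴰ-chain y y≥0 a)
  ≈-+ᴰ (chain a)      (chain b)      = top (ℕₚ.+-mono-≤ (ℕₚ.m≤m+n N a) (ℕₚ.m≤m+n N b))
  ≈-+ᴰ (chain a)      (top w≫)       = same-+ᴰ-top (std (N ℕ.+ a)) tt w≫
  ≈-+ᴰ (top {w} w≫)   x≈v            =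
    top (subst Large (+ᴰ-comm _ w) (Large-+ᴰ _ w (≈-NonNegʳ x≈v) w≫))

  same-*ᴰ-chain : ∀ x → NonNeg x → ∀ a → x *ᴰ nst (+ a) ≈ x *ᴰ std (N ℕ.+ a)
  same-*ᴰ-chain (std zero)          _  a = same tt
  same-*ᴰ-chain (std (suc zero))    _  a =
    subst (λ n → nst (+ a) ≈ std n) (sym (ℕₚ.+-identityʳ (N ℕ.+ a))) (chain a)
  same-*ᴰ-chain (std (suc (suc m))) _  a =
    top (ℕₚ.+-mono-≤ (ℕₚ.m≤m+n N a) (ℕₚ.≤-trans (ℕₚ.m≤m+n N a) (ℕₚ.m≤m+n _ _)))
  same-*ᴰ-chain (nst (+ _))         _  a = top tt
  same-*ᴰ-chain ω                   _  a = top tt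
  same-*ᴰ-chain (nst -[1+ _ ])      () a

  same-*ᴰ-top : ∀ x {w} → Large w → x *ᴰ ω ≈ x *ᴰ w
  same-*ᴰ-top x {w} w≫ with x ≟ᴰ std 0
  ... | yes refl = subst (std 0 ≈_) (sym (*ᴰ-zeroˡ w)) (same tt)
  ... | no x≢0   = subst (_≈ x *ᴰ w) (sym (*ᴰ-ωʳ x x≢0)) (top (Large-*ᴰ x w x≢0 w≫))

  ≈-*ᴰ : ∀ {x₁ w₁ x₂ w₂} → x₁ ≈ w₁ → x₂ ≈ w₂ → x₁ *ᴰ x₂ ≈ w₁ *ᴰ w₂
  ≈-*ᴰ (same {x} x≥0) (same {y} y≥0) = same (NonNeg-*ᴰ x y x≥0 y≥0)
  ≈-*ᴰ (same {x} x≥0) (chain a)      = same-*ᴰ-chain x x≥0 a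
  ≈-*ᴰ (same {x} _)   (top w≫)       = same-*ᴰ-top x w≫
  ≈-*ᴰ (chain a)      (same {y} y≥0) =
    subst₂ _≈_ (*ᴰ-comm y _) (*ᴰ-comm y _) (same-*ᴰ-chain y y≥0 a)
  ≈-*ᴰ (chain a)      (chain b)      = top (ℕₚ.≤-trans
    (ℕₚ.+-mono-≤ (ℕₚ.m≤m+n N b) (ℕₚ.m≤m+n N b))
    (ℕₚ.+-monoʳ-≤ (N ℕ.+ b) (ℕₚ.m≤m+n (N ℕ.+ b) _)))
  ≈-*ᴰ (chain a)      (top w≫)       = same-*ᴰ-top (std (N ℕ.+ a)) w≫
  ≈-*ᴰ (top {w} w≫)   (same {y} _)   = subst₂ _≈_ (*ᴰ-comm y ω) (*ᴰ-comm y w) (same-*ᴰ-top y w≫)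
  ≈-*ᴰ (top {w} w≫)   (chain b)      =
    subst (ω ≈_) (*ᴰ-comm (std (N ℕ.+ b)) w) (same-*ᴰ-top (std (N ℕ.+ b)) w≫)
  ≈-*ᴰ (top {w} w≫)   (top {v} v≫)   = top (Large-*ᴰ w v (Large⇒≢0 w w≫) v≫)

  ≈-⟦⟧ₜ : ∀ {n} {ρ : Env n} → (∀ i → NonNeg (ρ i)) → ∀ {x w} → x ≈ w →
          ∀ t → ⟦ t ⟧ₜ (ρ ▷ x) ≈ ⟦ t ⟧ₜ (ρ ▷ w)
  ≈-⟦⟧ₜ ρ≥0 x≈w (var zero)    = x≈w
  ≈-⟦⟧ₜ ρ≥0 x≈w (var (suc i)) = same (ρ≥0 i)
  ≈-⟦⟧ₜ ρ≥0 x≈w 𝟎             = same tt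
  ≈-⟦⟧ₜ ρ≥0 x≈w (S t)         = ≈-sucᴰ (≈-⟦⟧ₜ ρ≥0 x≈w t)
  ≈-⟦⟧ₜ ρ≥0 x≈w (t ⊕ s)       = ≈-+ᴰ (≈-⟦⟧ₜ ρ≥0 x≈w t) (≈-⟦⟧ₜ ρ≥0 x≈w s)
  ≈-⟦⟧ₜ ρ≥0 x≈w (t · s)       = ≈-*ᴰ (≈-⟦⟧ₜ ρ≥0 x≈w t) (≈-⟦⟧ₜ ρ≥0 x≈w s)

  ≈-injective : ∀ {x y w v} → x ≈ w → y ≈ v → w ≡ v → size x < N → size y < N → x ≡ y
  ≈-injective (same _)     (same _)     w≡v  _   _   = w≡v
  ≈-injective (same _)     (chain a)    refl x<N _   = ⊥-elim (ℕₚ.m+n≮m N a x<N)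
  ≈-injective (same {x} _) (top x≫)     refl x<N _   = Large-small x x≫ x<N
  ≈-injective (chain a)    (same _)     refl _   y<N = ⊥-elim (ℕₚ.m+n≮m N a y<N)
  ≈-injective (chain a)    (chain b)    e    _   _   =
    cong (nst ∘ +_) (ℕₚ.+-cancelˡ-≡ N a b (std-injective e))
  ≈-injective (chain a)    (top w≫)     refl x<N _   = ⊥-elim (ℕₚ.<⇒≱ x<N (ℕₚ.+-cancelˡ-≤ N N a w≫))
  ≈-injective (top w≫)     (same {y} _) refl x<N y<N = sym (Large-small y w≫ y<N)
  ≈-injective (top w≫)     (chain b)    refl _   y<N = ⊥-elim (ℕₚ.<⇒≱ y<N (ℕₚ.+-cancelˡ-≤ N N b w≫))
  ≈-injective (top _)      (top _)      _    _   _   = refl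

  standard-approximant : ∀ x → NonNeg x → ∃[ n ] x ≈ std n
  standard-approximant (std n)        _  = n , same tt
  standard-approximant (nst (+ a))    _  = N ℕ.+ a , chain a
  standard-approximant ω              _  = N ℕ.+ N , top ℕₚ.≤-refl
  standard-approximant (nst -[1+ _ ]) ()

Equation : ∀ {n} → Term (suc n) → Term (suc n) → Env n → D → Set
Equation t s ρ x = ⟦ t ⟧ₜ (ρ ▷ x) ≡ ⟦ s ⟧ₜ (ρ ▷ x)

nonneg-equation-transfer : ∀ {n} (t s : Term (suc n)) (ρ : Env n) → (∀ i → NonNeg (ρ i)) →
                           (∀ m → Equation t s ρ (std m)) → ∀ x → NonNeg x → Equation t s ρ x
nonneg-equation-transfer t s ρ ρ≥0 at-std x x≥0 =
  ≈-injective (≈-⟦⟧ₜ ρ≥0 x≈m t) (≈-⟦⟧ₜ ρ≥0 x≈m s) (at-std m) t<N s<N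
  where
  open Approximation (size (⟦ t ⟧ₜ (ρ ▷ x)) ℕ.+ size (⟦ s ⟧ₜ (ρ ▷ x)))
  m   = proj₁ (standard-approximant x x≥0)
  x≈m = proj₂ (standard-approximant x x≥0)
  t<N = s≤s (ℕₚ.m≤n⇒m≤1+n (ℕₚ.m≤m+n _ _))
  s<N = s≤s (ℕₚ.m≤n⇒m≤1+n (ℕₚ.m≤n+m _ _))

equation-transfer : ∀ {n} (t s : Term (suc n)) (ρ : Env n) →
                    (∀ m → Equation t s ρ (std m)) → ∀ x → Equation t s ρ x
equation-transfer t s ρ at-std x = shift-injective c _ _ (begin
  shift c (⟦ t ⟧ₜ (ρ ▷ x)) ≡⟨ ⟦⟧ₜ-shift c (shifted x) t ⟨
  ⟦ t ⟧ₜ (ρ′ ▷ shift c x)  ≡⟨ nonneg-equation-transfer t s ρ′ ρ′≥0 at-std′ (shift c x) x′≥0 ⟩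
  ⟦ s ⟧ₜ (ρ′ ▷ shift c x)  ≡⟨ ⟦⟧ₜ-shift c (shifted x) s ⟩
  shift c (⟦ s ⟧ₜ (ρ ▷ x)) ∎)
  where
  open ≡-Reasoning
  c  = totalDepth (ρ ▷ x)
  ρ′ = shift c ∘ ρ
  shifted : ∀ y i → (ρ′ ▷ shift c y) i ≡ shift c ((ρ ▷ y) i)
  shifted y zero    = refl
  shifted y (suc i) = refl
  at-std′ : ∀ m → Equation t s ρ′ (std m)
  at-std′ m = trans (⟦⟧ₜ-shift c (shifted (std m)) t)
              (trans (cong (shift c) (at-std m)) (sym (⟦⟧ₜ-shift c (shifted (std m)) s)))
  ρ′≥0 : ∀ i → NonNeg (ρ′ i)
  ρ′≥0 i = NonNeg-shift c (ρ i) (depth≤totalDepth (ρ ▷ x) (suc i))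
  x′≥0 = NonNeg-shift c x (depth≤totalDepth (ρ ▷ x) zero)

numeral≡std : ∀ n → numeral n ≡ std n
numeral≡std zero    = refl
numeral≡std (suc n) = cong sucᴰ (numeral≡std n)

𝔇-I= : IsModel I=
𝔇-I= = IndTheory-model 𝔇-Q λ { _ (isEq t s) ρ at-numerals → equation-transfer t s ρ
  (λ m → subst (Equation t s ρ) (numeral≡std m) (at-numerals m)) }

ω-greatest : ∀ x → x ≤′ ω
ω-greatest x ∀r≢ = ∀r≢ ω refl

ω≰ : ∀ {x} → x ≢ ω → ¬ (ω ≤′ x)
ω≰ x≢ω ω≤x = ω≤x (λ r r+ω≡x → x≢ω (trans (sym r+ω≡x) (+ᴰ-ωʳ r)))

std≤nst : ∀ m j → std m ≤′ nst j
std≤nst m j ∀r≢ = ∀r≢ (nst (j ℤ.- + m)) (cong nst (//-rightDividesˡ (+ m) j))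

rootSentence-unprovable : ∀ r → ¬ (I= ⊢ rootSentence r)
rootSentence-unprovable r = unprovable 𝔇-I= λ root →
  root ω (λ _ y-root → y-root (λ _ ¬Sy^r≤ω → ¬Sy^r≤ω (ω-greatest _)))

I=⊬I≤ : ¬ (I= ⊢Th I≤)
I=⊬I≤ I=⊢I≤ = unprovable 𝔇-I= doubling-induction-fails
  (I=⊢I≤ _ (ind {k = 1} (v0 ⊕ v0 ≼ v1) (isLe _ _)))
  where
  p : D
  p = nst (+ 0)
  step : ∀ x → x +ᴰ x ≤′ p → sucᴰ x +ᴰ sucᴰ x ≤′ p
  step (std n) _     = std≤nst (suc n ℕ.+ suc n) (+ 0)
  step (nst _) ω≤p   = ⊥-elim (ω≰ (λ ()) ω≤p)
  step ω       ω≤p   = ⊥-elim (ω≰ (λ ()) ω≤p)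
  doubling-induction-fails : ¬ ⟦ closeAll 1 (indInstance (v0 ⊕ v0 ≼ v1)) ⟧ (λ ())
  doubling-induction-fails instance′ =
    ω≰ (λ ()) (instance′ p (λ premises → premises (std≤nst 0 (+ 0)) step) p)

I=⊬I≰ : ¬ (I= ⊢Th I≰)
I=⊬I≰ I=⊢I≰ = unprovable 𝔇-I= ω-induction-fails
  (I=⊢I≰ _ (ind {k = 1} (¬' (v1 ≼ v0)) (isNLe _ _)))
  where
  step : ∀ x → ¬ (ω ≤′ x) → ¬ (ω ≤′ sucᴰ x)
  step (std _) _    = ω≰ (λ ())
  step (nst _) _    = ω≰ (λ ())
  step ω       ω≰ω  = ⊥-elim (ω≰ω (ω-greatest ω))
  ω-induction-fails : ¬ ⟦ closeAll 1 (indInstance (¬' (v1 ≼ v0))) ⟧ (λ ())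
  ω-induction-fails instance′ =
    instance′ ω (λ premises → premises (ω≰ (λ ())) step) ω (ω-greatest ω)

proposition3p2 : ((r : ℕ) → r ≥ 2 → ¬ (I= ⊢ rootSentence r))
    × (¬ (I= ⊢Th I≤) × ¬ (I= ⊢Th I≰))
proposition3p2 = (λ r _ → rootSentence-unprovable r) , I=⊬I≤ , I=⊬I≰
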